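{- If $T$ is a tree and $S_1,S_2$ are labelings with $(T,S_1)\in\mathscr{T}_{01,02}$ and $(T,S_2)\in\mathscr{T}_{01,02}$, then $S_1=S_2$.
   Context: A labeling of a tree $T$ is a map $S:V(T)\to\{A,B,C\}$ (statuses). Labeled trees: $(H_2,I^2)$: path on 4 vertices, endpoints status $A$, inner vertices status $B$. $(H_3,I^3)$: two adjacent vertices of status $C$, each adjacent to two leaves of status $A$. $(F_1,J^1)$: path $a,x,a'$ with statuses $A,C,A$. Operations on a labeled tree $(T',S')$ (statuses kept): $O_5$: add a disjoint copy of $(F_1,J^1)$ and an edge $ux$ with $u\in V(T')$ of status $C$ and $x$ the middle vertex of $F_1$. $O_6$: identify a vertex of $T'$ of status $A$ with a vertex of status $A$ of a disjoint copy of $(H_2,I^2)$ or $(H_3,I^3)$; the identified vertex has status $A$. $\mathscr{T}_{01,02}$ is the family of labeled trees $(T,S)$ for which there is a sequence $(T^1,S^1),\dots,(T^j,S^j)$, $j\ge1$, with $(T^1,S^1)$ a copy of $(H_2,I^2)$ or $(H_3,I^3)$, $(T^j,S^j)=(T,S)$, each term obtained from the previous by $O_5$ or $O_6$. -}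

module Defs where

open import Data.Nat using (ℕ; zero; suc; _+_; _≤_)
open import Data.Fin using (Fin; zero; suc; splitAt; _≟_)
open import Data.Bool using (Bool; true; false; _∧_; _∨_)
open import Data.Sum using (_⊎_; inj₁; inj₂)
open import Data.Product using (Σ; _×_; _,_)
open import Data.List using (List; []; _∷_; _++_; [_]; length)
open import Data.List.Relation.Unary.Linked using (Linked)
open import Data.List.Relation.Unary.Unique.Propositional using (Unique)
open import Relation.Nullary using (¬_; does)
open import Relation.Binary.PropositionalEquality using (_≡_)

data Status : Set where
  A B C : Status

Adj : ℕ → Set
Adj n = Fin n → Fin n → Bool

_==_ : ∀ {n} → Fin n → Fin n → Bool
i == j = does (i ≟ j)

fromEdges : ∀ {n} → List (Fin n × Fin n) → Adj n
fromEdges [] u v = false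
fromEdges ((a , b) ∷ es) u v =
  ((a == u) ∧ (b == v)) ∨ ((a == v) ∧ (b == u)) ∨ fromEdges es u v

module _ {n : ℕ} (adj : Adj n) where

  E : Fin n → Fin n → Set
  E u v = adj u v ≡ true

  data Walk : Fin n → Fin n → Set where
    here : ∀ {u} → Walk u u
    step : ∀ {u w v} → E u w → Walk w v → Walk u v

  IsCycle : List (Fin n) → Set
  IsCycle [] = Data.Empty.⊥ where import Data.Empty
  IsCycle (x ∷ xs) =
    (3 ≤ length (x ∷ xs)) × Unique (x ∷ xs) × Linked E ((x ∷ xs) ++ [ x ])

  record IsTree : Set where
    field
      nonempty   : 1 ≤ n
      symmetric  : ∀ u v → adj u v ≡ adj v u
      irreflexive : ∀ u → adj u u ≡ false
      connected  : ∀ u v → Walk u v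
      acyclic    : ∀ cs → ¬ IsCycle cs

record LGraph : Set where
  constructor lgraph
  field
    size : ℕ
    adj  : Adj size
    st   : Fin size → Status
open LGraph public

record Iso (G H : LGraph) : Set where
  field
    to      : Fin (size G) → Fin (size H)
    from    : Fin (size H) → Fin (size G)
    from-to : ∀ x → from (to x) ≡ x
    to-from : ∀ y → to (from y) ≡ y
    adj-pres : ∀ u v → adj G u v ≡ adj H (to u) (to v)
    st-pres  : ∀ u → st G u ≡ st H (to u)

v0 v1 v2 v3 v4 v5 : ∀ {n} → Fin (6 + n)
v0 = zero
v1 = suc zero
v2 = suc (suc zero)
v3 = suc (suc (suc zero))
v4 = suc (suc (suc (suc zero)))
v5 = suc (suc (suc (suc (suc zero))))

f0 f1 f2 f3 : Fin 4
f0 = zero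
f1 = suc zero
f2 = suc (suc zero)
f3 = suc (suc (suc zero))

g0 g1 g2 : Fin 3
g0 = zero
g1 = suc zero
g2 = suc (suc zero)

H₂ : LGraph
H₂ = lgraph 4 (fromEdges ((f0 , f1) ∷ (f1 , f2) ∷ (f2 , f3) ∷ [])) I²
  where
  I² : Fin 4 → Status
  I² zero = A
  I² (suc zero) = B
  I² (suc (suc zero)) = B
  I² (suc (suc (suc zero))) = A

H₃ : LGraph
H₃ = lgraph 6 (fromEdges ((v0 , v1) ∷ (v0 , v2) ∷ (v0 , v3) ∷ (v1 , v4) ∷ (v1 , v5) ∷ [])) I³
  where
  I³ : Fin 6 → Status
  I³ zero = C
  I³ (suc zero) = C
  I³ (suc (suc _)) = A

F₁ : LGraph
F₁ = lgraph 3 (fromEdges ((g0 , g1) ∷ (g1 , g2) ∷ [])) J¹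
  where
  J¹ : Fin 3 → Status
  J¹ zero = A
  J¹ (suc zero) = C
  J¹ (suc (suc zero)) = A

-- O₅: disjoint union of G and a copy of F₁ (vertices of G first, then
-- a, x, a'), plus the edge u x, where u has status C in G.
O₅ : (G : LGraph) → Fin (size G) → LGraph
O₅ G u = lgraph (size G + 3) adj' st'
  where
  x : Fin 3
  x = suc zero
  adj' : Adj (size G + 3)
  adj' i j with splitAt (size G) i | splitAt (size G) j
  ... | inj₁ p | inj₁ q = adj G p q
  ... | inj₂ p | inj₂ q = adj F₁ p q
  ... | inj₁ p | inj₂ q = (p == u) ∧ (q == x)
  ... | inj₂ p | inj₁ q = (q == u) ∧ (p == x)
  st' : Fin (size G + 3) → Status
  st' i with splitAt (size G) i
  ... | inj₁ p = st G p
  ... | inj₂ q = st F₁ q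

-- O₆: given a copy H of H₂ or H₃ whose vertex set is Fin (suc m), with the
-- vertex to be identified being `zero` (of status A), identify `zero` of H
-- with the vertex v of G (of status A).  Vertices of the result: those of
-- G, followed by the vertices `suc j` of H.
O₆ : (G : LGraph) → Fin (size G) → (m : ℕ) → (Fin (suc m) → Fin (suc m) → Bool)
   → (Fin (suc m) → Status) → LGraph
O₆ G v m hadj hst = lgraph (size G + m) adj' st'
  where
  adj' : Adj (size G + m)
  adj' i j with splitAt (size G) i | splitAt (size G) j
  ... | inj₁ p | inj₁ q = adj G p q
  ... | inj₂ p | inj₂ q = hadj (suc p) (suc q)
  ... | inj₁ p | inj₂ q = (p == v) ∧ hadj zero (suc q)
  ... | inj₂ p | inj₁ q = (q == v) ∧ hadj (suc p) zero
  st' : Fin (size G + m) → Status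
  st' i with splitAt (size G) i
  ... | inj₁ p = st G p
  ... | inj₂ q = hst (suc q)

data Generated : LGraph → Set where
  base₂ : Generated H₂
  base₃ : Generated H₃
  op₅   : ∀ {G} → Generated G → (u : Fin (size G)) → st G u ≡ C
        → Generated (O₅ G u)
  op₆   : ∀ {G} → Generated G → (v : Fin (size G)) → st G v ≡ A
        → (m : ℕ) (hadj : Fin (suc m) → Fin (suc m) → Bool)
          (hst : Fin (suc m) → Status)
        → (Iso (lgraph (suc m) hadj hst) H₂ ⊎ Iso (lgraph (suc m) hadj hst) H₃)
        → hst zero ≡ A
        → Generated (O₆ G v m hadj hst)

InFamily : (n : ℕ) → Adj n → (Fin n → Status) → Set
InFamily n adj S = Σ LGraph (λ G → Generated G × Iso G (lgraph n adj S))

-- A labeling in the family obeys local rules: no two adjacent vertices have status A; a B vertex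
-- has exactly two neighbours, of statuses A and B; a C vertex has at least three neighbours,
-- exactly two of status A and none of status B.  Conversely these rules admit only one labeling of
-- a generated tree.  Each operation glues a small piece (H₂, H₃, or F₁ plus the vertex it is
-- attached to) onto the previous tree at one vertex.  The rules at the other vertices of the piece
-- force its labels; as the piece gives the glued vertex no new A neighbour, nor a B neighbour when
-- it is C, the rules there are the same before and after gluing, so the labeling restricts to one
-- obeying the rules on the previous tree, and induction applies.

module Submission where

open import Defs
open import Data.Nat using (ℕ; zero; suc; _+_)
open import Data.Fin using (Fin; zero; suc; _≟_; splitAt; _↑ˡ_; _↑ʳ_)
open import Data.Fin.Properties
  using (all?; splitAt-↑ˡ; splitAt-↑ʳ; splitAt⁻¹-↑ˡ; splitAt⁻¹-↑ʳ; ↑ˡ-injective; ↑ʳ-injective)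
open import Data.Bool using (true; false; _∧_)
import Data.Bool.Properties as Bool
open import Data.Sum using (_⊎_; inj₁; inj₂; [_,_]′)
import Data.Sum as Sum
open import Data.Product using (∃; _×_; _,_; proj₁; proj₂)
open import Data.Empty using (⊥; ⊥-elim)
open import Function using (_∘_)
open import Data.Vec using (_∷_; []; lookup)
open import Relation.Nullary using (Dec; yes; no; ¬?)
open import Relation.Nullary.Decidable using (True; toWitness; from-yes; dec-true; dec-false; _→-dec_; _⊎-dec_)
open import Relation.Unary using (Decidable)
open import Relation.Binary.PropositionalEquality

A≢B : A ≢ B
A≢B ()

A≢C : A ≢ C
A≢C ()

B≢C : B ≢ C
B≢C ()

_≟ˢ_ : (s t : Status) → Dec (s ≡ t)
A ≟ˢ A = yes refl
B ≟ˢ B = yes refl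
C ≟ˢ C = yes refl
A ≟ˢ B = no λ ()
A ≟ˢ C = no λ ()
B ≟ˢ A = no λ ()
B ≟ˢ C = no λ ()
C ≟ˢ A = no λ ()
C ≟ˢ B = no λ ()

A-unless : ∀ {s} → s ≢ B → s ≢ C → s ≡ A
A-unless {A} _ _ = refl
A-unless {B} ≢B _ = ⊥-elim (≢B refl)
A-unless {C} _ ≢C = ⊥-elim (≢C refl)

B-unless : ∀ {s} → s ≢ A → s ≢ C → s ≡ B
B-unless {A} ≢A _ = ⊥-elim (≢A refl)
B-unless {B} _ _ = refl
B-unless {C} _ ≢C = ⊥-elim (≢C refl)

C-unless : ∀ {s} → s ≢ A → s ≢ B → s ≡ C
C-unless {A} ≢A _ = ⊥-elim (≢A refl)
C-unless {B} _ ≢B = ⊥-elim (≢B refl)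
C-unless {C} _ _ = refl

C⇒≢A : ∀ {s} → s ≡ C → s ≢ A
C⇒≢A refl ()

pigeonhole : ∀ {n} {p q r x y : Fin n} → p ≢ q → p ≢ r → q ≢ r
  → p ≡ x ⊎ p ≡ y → q ≡ x ⊎ q ≡ y → r ≡ x ⊎ r ≡ y → ⊥
pigeonhole p≢q _   _   (inj₁ refl) (inj₁ refl) _           = p≢q refl
pigeonhole _   p≢r _   (inj₁ refl) (inj₂ _)    (inj₁ refl) = p≢r refl
pigeonhole _   _   q≢r (inj₁ _)    (inj₂ refl) (inj₂ refl) = q≢r refl
pigeonhole p≢q _   _   (inj₂ refl) (inj₂ refl) _           = p≢q refl
pigeonhole _   p≢r _   (inj₂ refl) (inj₁ _)    (inj₂ refl) = p≢r refl
pigeonhole _   _   q≢r (inj₂ _)    (inj₁ refl) (inj₁ refl) = q≢r refl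

-- Local rules

record ThreeNeighbours {n : ℕ} (adj : Adj n) (u : Fin n) : Set where
  constructor three
  field
    w₁ w₂ w₃ : Fin n
    w₁-adj : E adj u w₁
    w₂-adj : E adj u w₂
    w₃-adj : E adj u w₃
    w₁≢w₂ : w₁ ≢ w₂
    w₁≢w₃ : w₁ ≢ w₃
    w₂≢w₃ : w₂ ≢ w₃

module _ {n : ℕ} (adj : Adj n) (S : Fin n → Status) (u : Fin n) where

  record BRule : Set where
    constructor b-rule
    field
      x y : Fin n
      x-adj : E adj u x
      x-st : S x ≡ A
      y-adj : E adj u y
      y-st : S y ≡ B
      neighbours : ∀ z → E adj u z → z ≡ x ⊎ z ≡ y

  record CRule : Set where
    constructor c-rule
    field
      x y : Fin n
      x≢y : x ≢ y
      x-adj : E adj u x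
      y-adj : E adj u y
      x-st : S x ≡ A
      y-st : S y ≡ A
      A-neighbours : ∀ z → E adj u z → S z ≡ A → z ≡ x ⊎ z ≡ y
      no-B-neighbour : ∀ z → E adj u z → S z ≢ B
      degree≥3 : ThreeNeighbours adj u

  record WellLabelledAt : Set where
    field
      A-rule : S u ≡ A → ∀ w → E adj u w → S w ≢ A
      B-rule : S u ≡ B → BRule
      C-rule : S u ≡ C → CRule

WellLabelled : ∀ {n} → Adj n → (Fin n → Status) → Set
WellLabelled adj S = ∀ u → WellLabelledAt adj S u

WellLabelledExcept : ∀ {n} → Adj n → (Fin n → Status) → Fin n → Set
WellLabelledExcept adj S b = ∀ a → a ≢ b → WellLabelledAt adj S a

Valid : LGraph → Set
Valid G = WellLabelled (adj G) (st G)

UniquelyLabelled : LGraph → Set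
UniquelyLabelled G = ∀ S → WellLabelled (adj G) S → ∀ z → S z ≡ st G z

Rigid : (K : LGraph) → Fin (size K) → Set
Rigid K b = ∀ T → WellLabelledExcept (adj K) T b → ∀ a → T a ≡ st K a

module _ {n : ℕ} {adj : Adj n} {T : Fin n → Status} {u : Fin n} where

  A-vertex-valid : T u ≡ A → (∀ w → E adj u w → T w ≢ A) → WellLabelledAt adj T u
  A-vertex-valid u-A no-A = record
    { A-rule = λ _ → no-A
    ; B-rule = λ u-B → ⊥-elim (A≢B (trans (sym u-A) u-B))
    ; C-rule = λ u-C → ⊥-elim (A≢C (trans (sym u-A) u-C))
    }

  B-vertex-valid : T u ≡ B → BRule adj T u → WellLabelledAt adj T u
  B-vertex-valid u-B β = record
    { A-rule = λ u-A → ⊥-elim (A≢B (trans (sym u-A) u-B))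
    ; B-rule = λ _ → β
    ; C-rule = λ u-C → ⊥-elim (B≢C (trans (sym u-B) u-C))
    }

  C-vertex-valid : T u ≡ C → CRule adj T u → WellLabelledAt adj T u
  C-vertex-valid u-C γ = record
    { A-rule = λ u-A → ⊥-elim (A≢C (trans (sym u-A) u-C))
    ; B-rule = λ u-B → ⊥-elim (B≢C (trans (sym u-B) u-C))
    ; C-rule = λ _ → γ
    }

  B-neighbours : BRule adj T u → ∀ p q → (∀ z → E adj u z → z ≡ p ⊎ z ≡ q)
    → (T p ≡ A × T q ≡ B) ⊎ (T p ≡ B × T q ≡ A)
  B-neighbours (b-rule x y x-adj x-st y-adj y-st _) p q nb with nb x x-adj | nb y y-adj
  ... | inj₁ refl | inj₁ refl = ⊥-elim (A≢B (trans (sym x-st) y-st))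
  ... | inj₁ refl | inj₂ refl = inj₁ (x-st , y-st)
  ... | inj₂ refl | inj₁ refl = inj₂ (y-st , x-st)
  ... | inj₂ refl | inj₂ refl = ⊥-elim (A≢B (trans (sym x-st) y-st))

  module _ (ω : WellLabelledAt adj T u) where
    open WellLabelledAt ω

    two-neighbours⇒¬C : ∀ x y → (∀ z → E adj u z → z ≡ x ⊎ z ≡ y) → T u ≢ C
    two-neighbours⇒¬C x y nb u-C with CRule.degree≥3 (C-rule u-C)
    ... | three p q r p-adj q-adj r-adj p≢q p≢r q≢r =
      pigeonhole p≢q p≢r q≢r (nb p p-adj) (nb q q-adj) (nb r r-adj)

    three-neighbours⇒¬B : ThreeNeighbours adj u → T u ≢ B
    three-neighbours⇒¬B (three p q r p-adj q-adj r-adj p≢q p≢r q≢r) u-B =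
      pigeonhole p≢q p≢r q≢r (nb p p-adj) (nb q q-adj) (nb r r-adj)
      where open BRule (B-rule u-B) renaming (neighbours to nb)

    leaf⇒A : ∀ w → (∀ z → E adj u z → z ≡ w) → T u ≡ A
    leaf⇒A w nb = A-unless ¬B (two-neighbours⇒¬C w w (λ z → inj₁ ∘ nb z))
      where
      ¬B : T u ≢ B
      ¬B u-B with B-rule u-B
      ... | b-rule x y x-adj x-st y-adj y-st _ with nb x x-adj | nb y y-adj
      ... | refl | refl = A≢B (trans (sym x-st) y-st)

    two-non-A⇒¬C : ∀ p q r → (∀ z → E adj u z → z ≡ p ⊎ z ≡ q ⊎ z ≡ r)
      → T p ≢ A → T q ≢ A → T u ≢ C
    two-non-A⇒¬C p q r nb p≢A q≢A u-C with C-rule u-C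
    ... | c-rule x y x≢y x-adj y-adj x-st y-st _ _ _ with nb x x-adj | nb y y-adj
    ... | inj₁ refl        | _                = p≢A x-st
    ... | inj₂ (inj₁ refl) | _                = q≢A x-st
    ... | _                | inj₁ refl        = p≢A y-st
    ... | _                | inj₂ (inj₁ refl) = q≢A y-st
    ... | inj₂ (inj₂ refl) | inj₂ (inj₂ refl) = x≢y refl

    two-of-three-A⇒C : (τ : ThreeNeighbours adj u) → let open ThreeNeighbours τ in
      T w₂ ≡ A → T w₃ ≡ A → T u ≡ C × T w₁ ≡ C
    two-of-three-A⇒C τ@(three p q r p-adj q-adj r-adj p≢q p≢r q≢r) q-A r-A = u-C , C-unless p≢A p≢B
      where
      u-C : T u ≡ C
      u-C = C-unless (λ u-A → A-rule u-A q q-adj q-A) (three-neighbours⇒¬B τ)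
      p≢A : T p ≢ A
      p≢A p-A with C-rule u-C
      ... | c-rule x y _ _ _ _ _ A-nb _ _ =
        pigeonhole p≢q p≢r q≢r (A-nb p p-adj p-A) (A-nb q q-adj q-A) (A-nb r r-adj r-A)
      p≢B : T p ≢ B
      p≢B = CRule.no-B-neighbour (C-rule u-C) p p-adj

three-map : ∀ {k n} {adjK : Adj k} {adjG : Adj n} {a : Fin k} (f : Fin k → Fin n)
  → (∀ c d → f c ≡ f d → c ≡ d) → (∀ c → E adjK a c → E adjG (f a) (f c))
  → ThreeNeighbours adjK a → ThreeNeighbours adjG (f a)
three-map f f-inj f-adj (three p q r p-adj q-adj r-adj p≢q p≢r q≢r) =
  three (f p) (f q) (f r) (f-adj p p-adj) (f-adj q q-adj) (f-adj r r-adj)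
    (p≢q ∘ f-inj p q) (p≢r ∘ f-inj p r) (q≢r ∘ f-inj q r)

record LocalEmbedding {k n : ℕ} (adjK : Adj k) (adjG : Adj n) (f : Fin k → Fin n) (a : Fin k) : Set where
  field
    injective : ∀ c d → f c ≡ f d → c ≡ d
    adj-to : ∀ c → E adjK a c → E adjG (f a) (f c)
    adj-from : ∀ z → E adjG (f a) z → ∃ λ c → z ≡ f c × E adjK a c

module Transfer {k n : ℕ} {adjK : Adj k} {adjG : Adj n} {f : Fin k → Fin n} {a : Fin k}
  (φ : LocalEmbedding adjK adjG f a) {T : Fin k → Status} {S : Fin n → Status}
  (S∘f : ∀ c → S (f c) ≡ T c) where
  open LocalEmbedding φ

  private
    toS : ∀ {c s} → T c ≡ s → S (f c) ≡ s
    toS {c} = trans (S∘f c)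

    toT : ∀ {c s} → S (f c) ≡ s → T c ≡ s
    toT {c} = trans (sym (S∘f c))

    image-of : ∀ {x y : Fin k} → (∀ z → E adjK a z → z ≡ x ⊎ z ≡ y)
      → ∀ z → E adjG (f a) z → z ≡ f x ⊎ z ≡ f y
    image-of nb z z-adj with adj-from z z-adj
    ... | c , refl , c-adj = Sum.map (cong f) (cong f) (nb c c-adj)

    preimage-of : ∀ {x y : Fin k} → (∀ z → E adjG (f a) z → z ≡ f x ⊎ z ≡ f y)
      → ∀ z → E adjK a z → z ≡ x ⊎ z ≡ y
    preimage-of nb z z-adj = Sum.map (injective z _) (injective z _) (nb (f z) (adj-to z z-adj))

  push : WellLabelledAt adjK T a → WellLabelledAt adjG S (f a)
  push ω = record { A-rule = A-rule′ ; B-rule = B-rule′ ; C-rule = C-rule′ }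
    where
    open WellLabelledAt ω
    A-rule′ : S (f a) ≡ A → ∀ w → E adjG (f a) w → S w ≢ A
    A-rule′ a-A w w-adj with adj-from w w-adj
    ... | c , refl , c-adj = A-rule (toT a-A) c c-adj ∘ toT
    B-rule′ : S (f a) ≡ B → BRule adjG S (f a)
    B-rule′ a-B with B-rule (toT a-B)
    ... | b-rule x y x-adj x-st y-adj y-st nb =
      b-rule (f x) (f y) (adj-to x x-adj) (toS x-st) (adj-to y y-adj) (toS y-st) (image-of nb)
    C-rule′ : S (f a) ≡ C → CRule adjG S (f a)
    C-rule′ a-C with C-rule (toT a-C)
    ... | c-rule x y x≢y x-adj y-adj x-st y-st A-nb no-B τ =
      c-rule (f x) (f y) (x≢y ∘ injective x y) (adj-to x x-adj) (adj-to y y-adj) (toS x-st) (toS y-st)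
        A-nb′ no-B′ (three-map f injective adj-to τ)
      where
      A-nb′ : ∀ z → E adjG (f a) z → S z ≡ A → z ≡ f x ⊎ z ≡ f y
      A-nb′ z z-adj z-A with adj-from z z-adj
      ... | c , refl , c-adj = Sum.map (cong f) (cong f) (A-nb c c-adj (toT z-A))
      no-B′ : ∀ z → E adjG (f a) z → S z ≢ B
      no-B′ z z-adj with adj-from z z-adj
      ... | c , refl , c-adj = no-B c c-adj ∘ toT

  pull : WellLabelledAt adjG S (f a) → WellLabelledAt adjK T a
  pull ω = record { A-rule = A-rule′ ; B-rule = B-rule′ ; C-rule = C-rule′ }
    where
    open WellLabelledAt ω
    A-rule′ : T a ≡ A → ∀ w → E adjK a w → T w ≢ A
    A-rule′ a-A w w-adj = A-rule (toS a-A) (f w) (adj-to w w-adj) ∘ toS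
    B-rule′ : T a ≡ B → BRule adjK T a
    B-rule′ a-B with B-rule (toS a-B)
    ... | b-rule x y x-adj x-st y-adj y-st nb with adj-from x x-adj | adj-from y y-adj
    ... | x′ , refl , x′-adj | y′ , refl , y′-adj =
      b-rule x′ y′ x′-adj (toT x-st) y′-adj (toT y-st) (preimage-of nb)
    C-rule′ : T a ≡ C → CRule adjK T a
    C-rule′ a-C with C-rule (toS a-C)
    ... | c-rule x y x≢y x-adj y-adj x-st y-st A-nb no-B (three p q r p-adj q-adj r-adj p≢q p≢r q≢r)
      with adj-from x x-adj | adj-from y y-adj | adj-from p p-adj | adj-from q q-adj | adj-from r r-adj
    ... | x′ , refl , x′-adj | y′ , refl , y′-adj
        | p′ , refl , p′-adj | q′ , refl , q′-adj | r′ , refl , r′-adj =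
      c-rule x′ y′ (x≢y ∘ cong f) x′-adj y′-adj (toT x-st) (toT y-st) A-nb′ no-B′
        (three p′ q′ r′ p′-adj q′-adj r′-adj (p≢q ∘ cong f) (p≢r ∘ cong f) (q≢r ∘ cong f))
      where
      A-nb′ : ∀ z → E adjK a z → T z ≡ A → z ≡ x′ ⊎ z ≡ y′
      A-nb′ z z-adj z-A =
        Sum.map (injective z x′) (injective z y′) (A-nb (f z) (adj-to z z-adj) (toS z-A))
      no-B′ : ∀ z → E adjK a z → T z ≢ B
      no-B′ z z-adj = no-B (f z) (adj-to z z-adj) ∘ toS

Iso-refl : ∀ {G} → Iso G G
Iso-refl = record
  { to = λ a → a ; from = λ a → a ; from-to = λ _ → refl ; to-from = λ _ → refl
  ; adj-pres = λ _ _ → refl ; st-pres = λ _ → refl }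

Iso-sym : ∀ {G H} → Iso G H → Iso H G
Iso-sym {G} {H} I = record
  { to = from ; from = to ; from-to = to-from ; to-from = from-to
  ; adj-pres = λ a c →
      trans (cong₂ (adj H) (sym (to-from a)) (sym (to-from c))) (sym (adj-pres (from a) (from c)))
  ; st-pres = λ a → trans (cong (st H) (sym (to-from a))) (sym (st-pres (from a))) }
  where open Iso I

Iso-trans : ∀ {G H K} → Iso G H → Iso H K → Iso G K
Iso-trans I J = record
  { to = J.to ∘ I.to ; from = I.from ∘ J.from
  ; from-to = λ a → trans (cong I.from (J.from-to (I.to a))) (I.from-to a)
  ; to-from = λ a → trans (cong J.to (I.to-from (J.from a))) (J.to-from a)
  ; adj-pres = λ a c → trans (I.adj-pres a c) (J.adj-pres (I.to a) (I.to c))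
  ; st-pres = λ a → trans (I.st-pres a) (J.st-pres (I.to a)) }
  where
  module I = Iso I
  module J = Iso J

Iso-injective : ∀ {G H} (I : Iso G H) a c → Iso.to I a ≡ Iso.to I c → a ≡ c
Iso-injective I a c eq = trans (sym (from-to a)) (trans (cong from eq) (from-to c))
  where open Iso I

Iso⇒LocalEmbedding : ∀ {G H} (I : Iso G H) a → LocalEmbedding (adj G) (adj H) (Iso.to I) a
Iso⇒LocalEmbedding {G} {H} I a = record
  { injective = Iso-injective I
  ; adj-to = λ c c-adj → trans (sym (adj-pres a c)) c-adj
  ; adj-from = λ z z-adj → from z , sym (to-from z) ,
      trans (adj-pres a (from z)) (trans (cong (adj H (to a)) (to-from z)) z-adj) }
  where open Iso I

Iso-valid : ∀ {G H} → Iso G H → Valid G → Valid H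
Iso-valid {G} {H} I ω z = subst (WellLabelledAt (adj H) (st H)) (to-from z)
  (Transfer.push (Iso⇒LocalEmbedding I (from z)) (sym ∘ st-pres) (ω (from z)))
  where open Iso I

Iso-unique : ∀ {G H} → Iso G H → UniquelyLabelled G → UniquelyLabelled H
Iso-unique {G} {H} I uniq S ω z = begin
  S z                  ≡⟨ cong S (sym (to-from z)) ⟩
  S (to (from z))      ≡⟨ uniq (S ∘ to) ω′ (from z) ⟩
  st G (from z)        ≡⟨ st-pres (from z) ⟩
  st H (to (from z))   ≡⟨ cong (st H) (to-from z) ⟩
  st H z               ∎
  where
  open Iso I
  open ≡-Reasoning
  ω′ : WellLabelled (adj G) (S ∘ to)
  ω′ a = Transfer.pull (Iso⇒LocalEmbedding I a) (λ _ → refl) (ω (to a))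

-- Gluing a piece K onto G′, identifying b ∈ K with s ∈ G′

record Gluing (G′ G K : LGraph) (s : Fin (size G′)) (b : Fin (size K)) : Set where
  field
    old : Fin (size G′) → Fin (size G)
    new : Fin (size K) → Fin (size G)
    new-b : new b ≡ old s
    old-injective : ∀ p q → old p ≡ old q → p ≡ q
    new-injective : ∀ a c → new a ≡ new c → a ≡ c
    covers : ∀ z → (∃ λ p → z ≡ old p) ⊎ (∃ λ a → a ≢ b × z ≡ new a)
    old-adj : ∀ p q → adj G (old p) (old q) ≡ adj G′ p q
    new-adj : ∀ a c → a ≢ b ⊎ c ≢ b → adj G (new a) (new c) ≡ adj K a c
    old-new-adj : ∀ p a → p ≢ s → a ≢ b → adj G (old p) (new a) ≡ false
    new-old-adj : ∀ p a → p ≢ s → a ≢ b → adj G (new a) (old p) ≡ false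
    old-st : ∀ p → st G (old p) ≡ st G′ p
    new-st : ∀ a → a ≢ b → st G (new a) ≡ st K a
    glued-st : st G′ s ≡ st K b

record Piece (K : LGraph) (b : Fin (size K)) : Set where
  field
    b≢B : st K b ≢ B
    no-A-neighbour : ∀ c → E (adj K) b c → st K c ≢ A
    C⇒no-B-neighbour : st K b ≡ C → ∀ c → E (adj K) b c → st K c ≢ B
    valid : WellLabelledExcept (adj K) (st K) b
    rigid : Rigid K b

module _ {G′ G K : LGraph} {s : Fin (size G′)} {b : Fin (size K)}
  (Γ : Gluing G′ G K s b) (π : Piece K b) where
  open Gluing Γ
  open Piece π

  private
    true≢false : true ≢ false
    true≢false ()

  old-embedding : ∀ p → p ≢ s → LocalEmbedding (adj G′) (adj G) old p
  old-embedding p p≢s = record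
    { injective = old-injective ; adj-to = λ c → trans (old-adj p c) ; adj-from = adj-from }
    where
    adj-from : ∀ z → E (adj G) (old p) z → ∃ λ c → z ≡ old c × E (adj G′) p c
    adj-from z z-adj with covers z
    ... | inj₁ (q , refl) = q , refl , trans (sym (old-adj p q)) z-adj
    ... | inj₂ (a , a≢b , refl) = ⊥-elim (true≢false (trans (sym z-adj) (old-new-adj p a p≢s a≢b)))

  new-embedding : ∀ a → a ≢ b → LocalEmbedding (adj K) (adj G) new a
  new-embedding a a≢b = record
    { injective = new-injective ; adj-to = λ c → trans (new-adj a c (inj₁ a≢b)) ; adj-from = adj-from }
    where
    adj-from : ∀ z → E (adj G) (new a) z → ∃ λ c → z ≡ new c × E (adj K) a c
    adj-from z z-adj with covers z
    ... | inj₂ (c , _ , refl) = c , refl , trans (sym (new-adj a c (inj₁ a≢b))) z-adj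
    ... | inj₁ (q , refl) with q ≟ s
    ...   | no q≢s = ⊥-elim (true≢false (trans (sym z-adj) (new-old-adj q a q≢s a≢b)))
    ...   | yes refl = b , sym new-b ,
            trans (sym (new-adj a b (inj₁ a≢b))) (subst (E (adj G) (new a)) (sym new-b) z-adj)

  glued-neighbour : ∀ z → E (adj G) (old s) z
    → (∃ λ q → z ≡ old q × E (adj G′) s q) ⊎ (∃ λ c → z ≡ new c × E (adj K) b c)
  glued-neighbour z z-adj with covers z
  ... | inj₁ (q , refl) = inj₁ (q , refl , trans (sym (old-adj s q)) z-adj)
  ... | inj₂ (c , c≢b , refl) = inj₂ (c , refl ,
          trans (sym (new-adj b c (inj₂ c≢b))) (subst (λ w → E (adj G) w (new c)) (sym new-b) z-adj))

  module GluedVertex {S : Fin (size G) → Status} {S′ : Fin (size G′) → Status}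
    (S∘old : ∀ p → S (old p) ≡ S′ p) (S∘new : ∀ a → S (new a) ≡ st K a) where

    private
      toS : ∀ {p t} → S′ p ≡ t → S (old p) ≡ t
      toS {p} = trans (S∘old p)

      toS′ : ∀ {p t} → S (old p) ≡ t → S′ p ≡ t
      toS′ {p} = trans (sym (S∘old p))

      toK : ∀ {c t} → S (new c) ≡ t → st K c ≡ t
      toK {c} = trans (sym (S∘new c))

      s-st : ∀ {t} → S (old s) ≡ t → st K b ≡ t
      s-st = toK ∘ trans (cong S new-b)

    push : WellLabelledAt (adj G′) S′ s → WellLabelledAt (adj G) S (old s)
    push ω = record { A-rule = A-rule′ ; B-rule = λ s-B → ⊥-elim (b≢B (s-st s-B)) ; C-rule = C-rule′ }
      where
      open WellLabelledAt ω
      A-rule′ : S (old s) ≡ A → ∀ w → E (adj G) (old s) w → S w ≢ A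
      A-rule′ s-A w w-adj with glued-neighbour w w-adj
      ... | inj₁ (q , refl , q-adj) = A-rule (toS′ s-A) q q-adj ∘ toS′
      ... | inj₂ (c , refl , c-adj) = no-A-neighbour c c-adj ∘ toK
      C-rule′ : S (old s) ≡ C → CRule (adj G) S (old s)
      C-rule′ s-C with C-rule (toS′ s-C)
      ... | c-rule x y x≢y x-adj y-adj x-st y-st A-nb no-B τ =
        c-rule (old x) (old y) (x≢y ∘ old-injective x y) (trans (old-adj s x) x-adj) (trans (old-adj s y) y-adj)
          (toS x-st) (toS y-st) A-nb′ no-B′ (three-map old old-injective (λ c → trans (old-adj s c)) τ)
        where
        A-nb′ : ∀ z → E (adj G) (old s) z → S z ≡ A → z ≡ old x ⊎ z ≡ old y
        A-nb′ z z-adj z-A with glued-neighbour z z-adj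
        ... | inj₁ (q , refl , q-adj) = Sum.map (cong old) (cong old) (A-nb q q-adj (toS′ z-A))
        ... | inj₂ (c , refl , c-adj) = ⊥-elim (no-A-neighbour c c-adj (toK z-A))
        no-B′ : ∀ z → E (adj G) (old s) z → S z ≢ B
        no-B′ z z-adj with glued-neighbour z z-adj
        ... | inj₁ (q , refl , q-adj) = no-B q q-adj ∘ toS′
        ... | inj₂ (c , refl , c-adj) = C⇒no-B-neighbour (s-st s-C) c c-adj ∘ toK

    pull : (st K b ≡ C → ThreeNeighbours (adj G′) s)
      → WellLabelledAt (adj G) S (old s) → WellLabelledAt (adj G′) S′ s
    pull degree≥3 ω = record
      { A-rule = A-rule′ ; B-rule = λ s-B → ⊥-elim (b≢B (s-st (toS s-B))) ; C-rule = C-rule′ }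
      where
      open WellLabelledAt ω
      A-rule′ : S′ s ≡ A → ∀ w → E (adj G′) s w → S′ w ≢ A
      A-rule′ s-A w w-adj = A-rule (toS s-A) (old w) (trans (old-adj s w) w-adj) ∘ toS
      old-A-neighbour : ∀ z → E (adj G) (old s) z → S z ≡ A → ∃ λ q → z ≡ old q × E (adj G′) s q
      old-A-neighbour z z-adj z-A with glued-neighbour z z-adj
      ... | inj₁ q = q
      ... | inj₂ (c , refl , c-adj) = ⊥-elim (no-A-neighbour c c-adj (toK z-A))
      C-rule′ : S′ s ≡ C → CRule (adj G′) S′ s
      C-rule′ s-C with C-rule (toS s-C)
      ... | c-rule x y x≢y x-adj y-adj x-st y-st A-nb no-B _
        with old-A-neighbour x x-adj x-st | old-A-neighbour y y-adj y-st
      ... | x′ , refl , x′-adj | y′ , refl , y′-adj =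
        c-rule x′ y′ (x≢y ∘ cong old) x′-adj y′-adj (toS′ x-st) (toS′ y-st) A-nb′ no-B′
          (degree≥3 (s-st (toS s-C)))
        where
        A-nb′ : ∀ z → E (adj G′) s z → S′ z ≡ A → z ≡ x′ ⊎ z ≡ y′
        A-nb′ z z-adj z-A = Sum.map (old-injective z x′) (old-injective z y′)
          (A-nb (old z) (trans (old-adj s z) z-adj) (toS z-A))
        no-B′ : ∀ z → E (adj G′) s z → S′ z ≢ B
        no-B′ z z-adj = no-B (old z) (trans (old-adj s z) z-adj) ∘ toS

  st∘new : ∀ a → st G (new a) ≡ st K a
  st∘new a with a ≟ b
  ... | no a≢b = new-st a a≢b
  ... | yes refl = trans (cong (st G) new-b) (trans (old-st s) glued-st)

  gluing-valid : Valid G′ → Valid G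
  gluing-valid ω z with covers z
  ... | inj₂ (a , a≢b , refl) = Transfer.push (new-embedding a a≢b) st∘new (valid a a≢b)
  ... | inj₁ (p , refl) with p ≟ s
  ...   | yes refl = GluedVertex.push old-st st∘new (ω s)
  ...   | no p≢s = Transfer.push (old-embedding p p≢s) old-st (ω p)

  gluing-unique : Valid G′ → UniquelyLabelled G′ → UniquelyLabelled G
  gluing-unique ωG′ uniq S ω = agree
    where
    S∘new : ∀ a → S (new a) ≡ st K a
    S∘new = rigid (S ∘ new) (λ a a≢b → Transfer.pull (new-embedding a a≢b) (λ _ → refl) (ω (new a)))
    ω′ : WellLabelled (adj G′) (S ∘ old)
    ω′ q with q ≟ s
    ... | yes refl = GluedVertex.pull (λ _ → refl) S∘new
          (λ b-C → CRule.degree≥3 (WellLabelledAt.C-rule (ωG′ s) (trans glued-st b-C))) (ω (old s))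
    ... | no q≢s = Transfer.pull (old-embedding q q≢s) (λ _ → refl) (ω (old q))
    S∘old : ∀ q → S (old q) ≡ st G′ q
    S∘old = uniq (S ∘ old) ω′
    agree : ∀ z → S z ≡ st G z
    agree z with covers z
    ... | inj₁ (p , refl) = trans (S∘old p) (sym (old-st p))
    ... | inj₂ (a , a≢b , refl) = trans (S∘new a) (sym (new-st a a≢b))

neighbours? : ∀ {k} (adj : Adj k) (u : Fin k) {P : Fin k → Set} → Decidable P
  → Dec (∀ z → E adj u z → P z)
neighbours? adj u P? = all? λ z → (adj u z Bool.≟ true) →-dec P? z

non-A-neighbours? : (K : LGraph) (u : Fin (size K)) → Dec (∀ w → E (adj K) u w → st K w ≢ A)
non-A-neighbours? K u = neighbours? (adj K) u λ w → ¬? (st K w ≟ˢ A)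

non-B-neighbours? : (K : LGraph) (u : Fin (size K)) → Dec (∀ w → E (adj K) u w → st K w ≢ B)
non-B-neighbours? K u = neighbours? (adj K) u λ w → ¬? (st K w ≟ˢ B)

A-neighbours? : (K : LGraph) (u x y : Fin (size K))
  → Dec (∀ z → E (adj K) u z → st K z ≡ A → z ≡ x ⊎ z ≡ y)
A-neighbours? K u x y = neighbours? (adj K) u λ z → (st K z ≟ˢ A) →-dec (z ≟ x ⊎-dec z ≟ y)

involution : (K : LGraph) (r : Fin (size K) → Fin (size K))
  → {True (all? λ a → r (r a) ≟ a)}
  → {True (all? λ a → all? λ c → adj K a c Bool.≟ adj K (r a) (r c))}
  → {True (all? λ a → st K a ≟ˢ st K (r a))}
  → Iso K K
involution K r {r-inv} {r-adj} {r-st} = record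
  { to = r ; from = r ; from-to = toWitness r-inv ; to-from = toWitness r-inv
  ; adj-pres = toWitness r-adj ; st-pres = toWitness r-st }

-- Lets the vertex of an O₆ copy that is identified be moved to a fixed vertex of H₂ or H₃.
A-Transitive : (K : LGraph) → Fin (size K) → Set
A-Transitive K b = ∀ t → st K t ≡ A → ∃ λ (R : Iso K K) → Iso.to R b ≡ t

H₂-nb₁ : ∀ z → E (adj H₂) f1 z → z ≡ f0 ⊎ z ≡ f2
H₂-nb₁ = from-yes (neighbours? (adj H₂) f1 λ z → z ≟ f0 ⊎-dec z ≟ f2)

H₂-nb₂ : ∀ z → E (adj H₂) f2 z → z ≡ f1 ⊎ z ≡ f3
H₂-nb₂ = from-yes (neighbours? (adj H₂) f2 λ z → z ≟ f1 ⊎-dec z ≟ f3)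

H₂-nb₃ : ∀ z → E (adj H₂) f3 z → z ≡ f2
H₂-nb₃ = from-yes (neighbours? (adj H₂) f3 (_≟ f2))

H₂-valid : Valid H₂
H₂-valid zero = A-vertex-valid refl (from-yes (non-A-neighbours? H₂ f0))
H₂-valid (suc zero) = B-vertex-valid refl (b-rule f0 f2 refl refl refl refl H₂-nb₁)
H₂-valid (suc (suc zero)) = B-vertex-valid refl
  (b-rule f3 f1 refl refl refl refl (λ z → Sum.swap ∘ H₂-nb₂ z))
H₂-valid (suc (suc (suc zero))) = A-vertex-valid refl (from-yes (non-A-neighbours? H₂ f3))

H₂-rigid : Rigid H₂ f0
H₂-rigid T ω = agree
  where
  ω₁ = ω f1 λ ()
  ω₂ = ω f2 λ ()
  ω₃ = ω f3 λ ()
  t₃ : T f3 ≡ A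
  t₃ = leaf⇒A ω₃ f2 H₂-nb₃
  t₂ : T f2 ≡ B
  t₂ = B-unless (WellLabelledAt.A-rule ω₃ t₃ f2 refl) (two-neighbours⇒¬C ω₂ f1 f3 H₂-nb₂)
  t₁ : T f1 ≡ B
  t₁ = [ (λ (_ , f3-B) → ⊥-elim (A≢B (trans (sym t₃) f3-B))) , proj₁ ]′
         (B-neighbours (WellLabelledAt.B-rule ω₂ t₂) f1 f3 H₂-nb₂)
  t₀ : T f0 ≡ A
  t₀ = [ proj₁ , (λ (_ , f2-A) → ⊥-elim (A≢B (trans (sym f2-A) t₂))) ]′
         (B-neighbours (WellLabelledAt.B-rule ω₁ t₁) f0 f2 H₂-nb₁)
  agree : ∀ a → T a ≡ st H₂ a
  agree zero = t₀
  agree (suc zero) = t₁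
  agree (suc (suc zero)) = t₂
  agree (suc (suc (suc zero))) = t₃

H₂-piece : Piece H₂ f0
H₂-piece = record
  { b≢B = λ ()
  ; no-A-neighbour = from-yes (non-A-neighbours? H₂ f0)
  ; C⇒no-B-neighbour = λ ()
  ; valid = λ a _ → H₂-valid a
  ; rigid = H₂-rigid
  }

H₂-A-transitive : A-Transitive H₂ f0
H₂-A-transitive zero _ = Iso-refl , refl
H₂-A-transitive (suc (suc (suc zero))) _ = involution H₂ (lookup (f3 ∷ f2 ∷ f1 ∷ f0 ∷ [])) , refl

H₃-nb₀ : ∀ z → E (adj H₃) v0 z → z ≡ v1 ⊎ z ≡ v2 ⊎ z ≡ v3
H₃-nb₀ = from-yes (neighbours? (adj H₃) v0 λ z → z ≟ v1 ⊎-dec z ≟ v2 ⊎-dec z ≟ v3)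

H₃-nb₃ : ∀ z → E (adj H₃) v3 z → z ≡ v0
H₃-nb₃ = from-yes (neighbours? (adj H₃) v3 (_≟ v0))

H₃-nb₄ : ∀ z → E (adj H₃) v4 z → z ≡ v1
H₃-nb₄ = from-yes (neighbours? (adj H₃) v4 (_≟ v1))

H₃-nb₅ : ∀ z → E (adj H₃) v5 z → z ≡ v1
H₃-nb₅ = from-yes (neighbours? (adj H₃) v5 (_≟ v1))

H₃-valid : Valid H₃
H₃-valid zero = C-vertex-valid refl
  (c-rule v2 v3 (λ ()) refl refl refl refl (from-yes (A-neighbours? H₃ v0 v2 v3))
    (from-yes (non-B-neighbours? H₃ v0)) (three v1 v2 v3 refl refl refl (λ ()) (λ ()) (λ ())))
H₃-valid (suc zero) = C-vertex-valid refl
  (c-rule v4 v5 (λ ()) refl refl refl refl (from-yes (A-neighbours? H₃ v1 v4 v5))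
    (from-yes (non-B-neighbours? H₃ v1)) (three v0 v4 v5 refl refl refl (λ ()) (λ ()) (λ ())))
H₃-valid (suc (suc a)) = A-vertex-valid refl
  (from-yes (all? λ a → non-A-neighbours? H₃ (suc (suc a))) a)

H₃-rigid : Rigid H₃ v2
H₃-rigid T ω = agree
  where
  ω₀ = ω v0 λ ()
  ω₁ = ω v1 λ ()
  t₃ : T v3 ≡ A
  t₃ = leaf⇒A (ω v3 λ ()) v0 H₃-nb₃
  t₄ : T v4 ≡ A
  t₄ = leaf⇒A (ω v4 λ ()) v1 H₃-nb₄
  t₅ : T v5 ≡ A
  t₅ = leaf⇒A (ω v5 λ ()) v1 H₃-nb₅
  hub : T v1 ≡ C × T v0 ≡ C
  hub = two-of-three-A⇒C ω₁ (three v0 v4 v5 refl refl refl (λ ()) (λ ()) (λ ())) t₄ t₅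
  t₁ = proj₁ hub
  t₀ = proj₂ hub
  t₂ : T v2 ≡ A
  t₂ = A-unless (CRule.no-B-neighbour (WellLabelledAt.C-rule ω₀ t₀) v2 refl)
         (λ v2-C → two-non-A⇒¬C ω₀ v1 v2 v3 H₃-nb₀ (C⇒≢A t₁) (C⇒≢A v2-C) t₀)
  agree : ∀ a → T a ≡ st H₃ a
  agree zero = t₀
  agree (suc zero) = t₁
  agree (suc (suc zero)) = t₂
  agree (suc (suc (suc zero))) = t₃
  agree (suc (suc (suc (suc zero)))) = t₄
  agree (suc (suc (suc (suc (suc zero))))) = t₅

H₃-piece : Piece H₃ v2
H₃-piece = record
  { b≢B = λ ()
  ; no-A-neighbour = from-yes (non-A-neighbours? H₃ v2)
  ; C⇒no-B-neighbour = λ ()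
  ; valid = λ a _ → H₃-valid a
  ; rigid = H₃-rigid
  }

H₃-A-transitive : A-Transitive H₃ v2
H₃-A-transitive (suc (suc zero)) _ = Iso-refl , refl
H₃-A-transitive (suc (suc (suc zero))) _ =
  involution H₃ (lookup (v0 ∷ v1 ∷ v3 ∷ v2 ∷ v4 ∷ v5 ∷ [])) , refl
H₃-A-transitive (suc (suc (suc (suc zero)))) _ =
  involution H₃ (lookup (v1 ∷ v0 ∷ v4 ∷ v5 ∷ v2 ∷ v3 ∷ [])) , refl
H₃-A-transitive (suc (suc (suc (suc (suc zero))))) _ =
  involution H₃ (lookup (v1 ∷ v0 ∷ v5 ∷ v4 ∷ v3 ∷ v2 ∷ [])) , refl

-- F₁ with the vertex u of O₅ as vertex 0, joined to the middle vertex of F₁, whose vertices are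
-- shifted by one.  O₅ G u is the gluing of F₁⁺ onto G identifying 0 with u.
F₁⁺ : LGraph
F₁⁺ = lgraph 4 adj⁺ st⁺
  where
  adj⁺ : Adj 4
  adj⁺ zero zero = false
  adj⁺ zero (suc g) = g == g1
  adj⁺ (suc g) zero = g == g1
  adj⁺ (suc g) (suc h) = adj F₁ g h
  st⁺ : Fin 4 → Status
  st⁺ zero = C
  st⁺ (suc g) = st F₁ g

F₁⁺-nb₁ : ∀ z → E (adj F₁⁺) f1 z → z ≡ f2
F₁⁺-nb₁ = from-yes (neighbours? (adj F₁⁺) f1 (_≟ f2))

F₁⁺-nb₃ : ∀ z → E (adj F₁⁺) f3 z → z ≡ f2
F₁⁺-nb₃ = from-yes (neighbours? (adj F₁⁺) f3 (_≟ f2))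

F₁⁺-three : ThreeNeighbours (adj F₁⁺) f2
F₁⁺-three = three f0 f1 f3 refl refl refl (λ ()) (λ ()) (λ ())

F₁⁺-valid : WellLabelledExcept (adj F₁⁺) (st F₁⁺) f0
F₁⁺-valid zero f0≢f0 = ⊥-elim (f0≢f0 refl)
F₁⁺-valid (suc zero) _ = A-vertex-valid refl (from-yes (non-A-neighbours? F₁⁺ f1))
F₁⁺-valid (suc (suc zero)) _ = C-vertex-valid refl
  (c-rule f1 f3 (λ ()) refl refl refl refl (from-yes (A-neighbours? F₁⁺ f2 f1 f3))
    (from-yes (non-B-neighbours? F₁⁺ f2)) F₁⁺-three)
F₁⁺-valid (suc (suc (suc zero))) _ = A-vertex-valid refl (from-yes (non-A-neighbours? F₁⁺ f3))

F₁⁺-rigid : Rigid F₁⁺ f0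
F₁⁺-rigid T ω = agree
  where
  t₁ : T f1 ≡ A
  t₁ = leaf⇒A (ω f1 λ ()) f2 F₁⁺-nb₁
  t₃ : T f3 ≡ A
  t₃ = leaf⇒A (ω f3 λ ()) f2 F₁⁺-nb₃
  hub : T f2 ≡ C × T f0 ≡ C
  hub = two-of-three-A⇒C (ω f2 λ ()) F₁⁺-three t₁ t₃
  agree : ∀ a → T a ≡ st F₁⁺ a
  agree zero = proj₂ hub
  agree (suc zero) = t₁
  agree (suc (suc zero)) = proj₁ hub
  agree (suc (suc (suc zero))) = t₃

F₁⁺-piece : Piece F₁⁺ f0
F₁⁺-piece = record
  { b≢B = λ ()
  ; no-A-neighbour = from-yes (non-A-neighbours? F₁⁺ f0)
  ; C⇒no-B-neighbour = λ _ → from-yes (non-B-neighbours? F₁⁺ f0)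
  ; valid = F₁⁺-valid
  ; rigid = F₁⁺-rigid
  }

-- One-point amalgams: O₅ and O₆ as gluings

↑ˡ≢↑ʳ : ∀ {m k} (p : Fin m) (j : Fin k) → p ↑ˡ k ≢ m ↑ʳ j
↑ˡ≢↑ʳ {m} {k} p j eq
  with trans (sym (splitAt-↑ˡ m p k)) (trans (cong (splitAt m) eq) (splitAt-↑ʳ m k j))
... | ()

module _ (G : LGraph) (v : Fin (size G)) {m : ℕ} (hadj : Adj (suc m)) (hst : Fin (suc m) → Status) where

  attached : Fin (suc m) → Fin (size G + m)
  attached zero = v ↑ˡ m
  attached (suc j) = size G ↑ʳ j

  record IsAmalgam (adjM : Adj (size G + m)) (stM : Fin (size G + m) → Status) : Set where
    field
      adj-GG : ∀ p q → adjM (p ↑ˡ m) (q ↑ˡ m) ≡ adj G p q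
      adj-HH : ∀ i j → adjM (size G ↑ʳ i) (size G ↑ʳ j) ≡ hadj (suc i) (suc j)
      adj-GH : ∀ p j → adjM (p ↑ˡ m) (size G ↑ʳ j) ≡ (p == v) ∧ hadj zero (suc j)
      adj-HG : ∀ p j → adjM (size G ↑ʳ j) (p ↑ˡ m) ≡ (p == v) ∧ hadj (suc j) zero
      st-G : ∀ p → stM (p ↑ˡ m) ≡ st G p
      st-H : ∀ j → stM (size G ↑ʳ j) ≡ hst (suc j)

  module _ {adjM : Adj (size G + m)} {stM : Fin (size G + m) → Status} (M : IsAmalgam adjM stM) where
    open IsAmalgam M

    attached-adj : ∀ i j → i ≢ zero ⊎ j ≢ zero → adjM (attached i) (attached j) ≡ hadj i j
    attached-adj zero zero (inj₁ ≢0) = ⊥-elim (≢0 refl)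
    attached-adj zero zero (inj₂ ≢0) = ⊥-elim (≢0 refl)
    attached-adj zero (suc j) _ = trans (adj-GH v j) (cong (_∧ hadj zero (suc j)) (dec-true (v ≟ v) refl))
    attached-adj (suc i) zero _ = trans (adj-HG v i) (cong (_∧ hadj (suc i) zero) (dec-true (v ≟ v) refl))
    attached-adj (suc i) (suc j) _ = adj-HH i j

    attached-st : ∀ i → i ≢ zero → stM (attached i) ≡ hst i
    attached-st zero ≢0 = ⊥-elim (≢0 refl)
    attached-st (suc j) _ = st-H j

    attached-injective : ∀ i j → attached i ≡ attached j → i ≡ j
    attached-injective zero zero _ = refl
    attached-injective zero (suc j) eq = ⊥-elim (↑ˡ≢↑ʳ v j eq)
    attached-injective (suc i) zero eq = ⊥-elim (↑ˡ≢↑ʳ v i (sym eq))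
    attached-injective (suc i) (suc j) eq = cong suc (↑ʳ-injective (size G) i j eq)

    G-attached-adj : ∀ p i → p ≢ v → i ≢ zero
      → adjM (p ↑ˡ m) (attached i) ≡ false × adjM (attached i) (p ↑ˡ m) ≡ false
    G-attached-adj p zero _ ≢0 = ⊥-elim (≢0 refl)
    G-attached-adj p (suc j) p≢v _ =
      trans (adj-GH p j) (cong (_∧ hadj zero (suc j)) (dec-false (p ≟ v) p≢v)) ,
      trans (adj-HG p j) (cong (_∧ hadj (suc j) zero) (dec-false (p ≟ v) p≢v))

    amalgam-covers : ∀ z → (∃ λ p → z ≡ p ↑ˡ m) ⊎ (∃ λ j → z ≡ attached (suc j))
    amalgam-covers z with splitAt (size G) z in eq
    ... | inj₁ p = inj₁ (p , sym (splitAt⁻¹-↑ˡ eq))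
    ... | inj₂ j = inj₂ (j , sym (splitAt⁻¹-↑ʳ eq))

    amalgam-gluing : (K : LGraph) (b : Fin (size K)) (I : Iso K (lgraph (suc m) hadj hst))
      → Iso.to I b ≡ zero → st G v ≡ st K b → Gluing G (lgraph (size G + m) adjM stM) K v b
    amalgam-gluing K b I to-b v-st = record
      { old = _↑ˡ m
      ; new = attached ∘ to
      ; new-b = cong attached to-b
      ; old-injective = ↑ˡ-injective m
      ; new-injective = λ a c → Iso-injective I a c ∘ attached-injective (to a) (to c)
      ; covers = covers
      ; old-adj = adj-GG
      ; new-adj = λ a c ≢b → trans (attached-adj (to a) (to c) (Sum.map to≢0 to≢0 ≢b)) (sym (adj-pres a c))
      ; old-new-adj = λ p a p≢v a≢b → proj₁ (G-attached-adj p (to a) p≢v (to≢0 a≢b))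
      ; new-old-adj = λ p a p≢v a≢b → proj₂ (G-attached-adj p (to a) p≢v (to≢0 a≢b))
      ; old-st = st-G
      ; new-st = λ a a≢b → trans (attached-st (to a) (to≢0 a≢b)) (sym (st-pres a))
      ; glued-st = v-st
      }
      where
      open Iso I
      to≢0 : ∀ {a} → a ≢ b → to a ≢ zero
      to≢0 {a} a≢b eq = a≢b (Iso-injective I a b (trans eq (sym to-b)))
      covers : ∀ z → (∃ λ p → z ≡ p ↑ˡ m) ⊎ (∃ λ a → a ≢ b × z ≡ attached (to a))
      covers z with amalgam-covers z
      ... | inj₁ p = inj₁ p
      ... | inj₂ (j , refl) = inj₂ (from (suc j) , from≢b , cong attached (sym (to-from (suc j))))
        where
        from≢b : from (suc j) ≢ b
        from≢b eq with trans (sym to-b) (trans (cong to (sym eq)) (to-from (suc j)))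
        ... | ()

O₅-amalgam : ∀ G u → IsAmalgam G u (adj F₁⁺) (st F₁⁺) (adj (O₅ G u)) (st (O₅ G u))
O₅-amalgam G u = record
  { adj-GG = adj-GG ; adj-HH = adj-HH ; adj-GH = adj-GH ; adj-HG = adj-HG ; st-G = st-G ; st-H = st-H }
  where
  n = size G
  adj-GG : ∀ p q → adj (O₅ G u) (p ↑ˡ 3) (q ↑ˡ 3) ≡ adj G p q
  adj-GG p q rewrite splitAt-↑ˡ n p 3 | splitAt-↑ˡ n q 3 = refl
  adj-HH : ∀ i j → adj (O₅ G u) (n ↑ʳ i) (n ↑ʳ j) ≡ adj F₁ i j
  adj-HH i j rewrite splitAt-↑ʳ n 3 i | splitAt-↑ʳ n 3 j = refl
  adj-GH : ∀ p j → adj (O₅ G u) (p ↑ˡ 3) (n ↑ʳ j) ≡ (p == u) ∧ (j == g1)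
  adj-GH p j rewrite splitAt-↑ˡ n p 3 | splitAt-↑ʳ n 3 j = refl
  adj-HG : ∀ p j → adj (O₅ G u) (n ↑ʳ j) (p ↑ˡ 3) ≡ (p == u) ∧ (j == g1)
  adj-HG p j rewrite splitAt-↑ˡ n p 3 | splitAt-↑ʳ n 3 j = refl
  st-G : ∀ p → st (O₅ G u) (p ↑ˡ 3) ≡ st G p
  st-G p rewrite splitAt-↑ˡ n p 3 = refl
  st-H : ∀ j → st (O₅ G u) (n ↑ʳ j) ≡ st F₁ j
  st-H j rewrite splitAt-↑ʳ n 3 j = refl

O₆-amalgam : ∀ G v m hadj hst → IsAmalgam G v hadj hst (adj (O₆ G v m hadj hst)) (st (O₆ G v m hadj hst))
O₆-amalgam G v m hadj hst = record
  { adj-GG = adj-GG ; adj-HH = adj-HH ; adj-GH = adj-GH ; adj-HG = adj-HG ; st-G = st-G ; st-H = st-H }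
  where
  n = size G
  M = O₆ G v m hadj hst
  adj-GG : ∀ p q → adj M (p ↑ˡ m) (q ↑ˡ m) ≡ adj G p q
  adj-GG p q rewrite splitAt-↑ˡ n p m | splitAt-↑ˡ n q m = refl
  adj-HH : ∀ i j → adj M (n ↑ʳ i) (n ↑ʳ j) ≡ hadj (suc i) (suc j)
  adj-HH i j rewrite splitAt-↑ʳ n m i | splitAt-↑ʳ n m j = refl
  adj-GH : ∀ p j → adj M (p ↑ˡ m) (n ↑ʳ j) ≡ (p == v) ∧ hadj zero (suc j)
  adj-GH p j rewrite splitAt-↑ˡ n p m | splitAt-↑ʳ n m j = refl
  adj-HG : ∀ p j → adj M (n ↑ʳ j) (p ↑ˡ m) ≡ (p == v) ∧ hadj (suc j) zero
  adj-HG p j rewrite splitAt-↑ˡ n p m | splitAt-↑ʳ n m j = refl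
  st-G : ∀ p → st M (p ↑ˡ m) ≡ st G p
  st-G p rewrite splitAt-↑ˡ n p m = refl
  st-H : ∀ j → st M (n ↑ʳ j) ≡ hst (suc j)
  st-H j rewrite splitAt-↑ʳ n m j = refl

record Extension (G′ G : LGraph) : Set where
  field
    K : LGraph
    s : Fin (size G′)
    b : Fin (size K)
    gluing : Gluing G′ G K s b
    piece : Piece K b

O₅-extension : ∀ G u → st G u ≡ C → Extension G (O₅ G u)
O₅-extension G u u-C = record
  { K = F₁⁺ ; s = u ; b = f0
  ; gluing = amalgam-gluing G u (adj F₁⁺) (st F₁⁺) (O₅-amalgam G u) F₁⁺ f0 Iso-refl refl u-C
  ; piece = F₁⁺-piece }

O₆-extension : ∀ G v → st G v ≡ A → ∀ m hadj hst
  → Iso (lgraph (suc m) hadj hst) H₂ ⊎ Iso (lgraph (suc m) hadj hst) H₃ → hst zero ≡ A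
  → Extension G (O₆ G v m hadj hst)
O₆-extension G v v-A m hadj hst copy≅ h-A =
  [ attach H₂-piece refl H₂-A-transitive , attach H₃-piece refl H₃-A-transitive ]′ copy≅
  where
  attach : ∀ {K b} → Piece K b → st K b ≡ A → A-Transitive K b → Iso (lgraph (suc m) hadj hst) K
    → Extension G (O₆ G v m hadj hst)
  attach {K} {b} π b-A transitive I
    with transitive (Iso.to I zero) (trans (sym (Iso.st-pres I zero)) h-A)
  ... | R , R-b = record
    { K = K ; s = v ; b = b
    ; gluing = amalgam-gluing G v hadj hst (O₆-amalgam G v m hadj hst) K b (Iso-trans R (Iso-sym I))
        (trans (cong (Iso.from I) R-b) (Iso.from-to I zero)) (trans v-A (sym b-A))
    ; piece = π }

rigid⇒unique : ∀ {K b} → Rigid K b → UniquelyLabelled K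
rigid⇒unique rigid S ω = rigid S (λ a _ → ω a)

generated-valid : ∀ {G} → Generated G → Valid G
generated-valid base₂ = H₂-valid
generated-valid base₃ = H₃-valid
generated-valid (op₅ {G} g u u-C) = gluing-valid gluing piece (generated-valid g)
  where open Extension (O₅-extension G u u-C)
generated-valid (op₆ {G} g v v-A m hadj hst I h-A) = gluing-valid gluing piece (generated-valid g)
  where open Extension (O₆-extension G v v-A m hadj hst I h-A)

generated-unique : ∀ {G} → Generated G → UniquelyLabelled G
generated-unique base₂ = rigid⇒unique H₂-rigid
generated-unique base₃ = rigid⇒unique H₃-rigid
generated-unique (op₅ {G} g u u-C) = gluing-unique gluing piece (generated-valid g) (generated-unique g)
  where open Extension (O₅-extension G u u-C)
generated-unique (op₆ {G} g v v-A m hadj hst I h-A) =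
  gluing-unique gluing piece (generated-valid g) (generated-unique g)
  where open Extension (O₆-extension G v v-A m hadj hst I h-A)

corollary6p2 : (n : ℕ) (adj : Adj n) → IsTree adj
    → (S₁ S₂ : Fin n → Status)
    → InFamily n adj S₁ → InFamily n adj S₂
    → ∀ v → S₁ v ≡ S₂ v
corollary6p2 _ _ _ _ S₂ (_ , gen₁ , I₁) (_ , gen₂ , I₂) v =
  sym (Iso-unique I₁ (generated-unique gen₁) S₂ (Iso-valid I₂ (generated-valid gen₂)) v)
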